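{- Let $n\in\mathbb{N}\cup\{\infty\}$, let $V$ be a type with an equivalence $\sup:\mathsf{T}^n_U V\simeq V$, equipped with the induced relation $y\in x:=\mathrm{fib}\,\widetilde{x}\,y$. Then for every $(n-1)$-truncated map $f:\mathbb{N}\to V$ there is $a:V$ such that for all $z:V$, $z\in a\simeq\mathrm{fib}\,f\,z$ (i.e. $(V,\in)$ has natural numbers represented by $f$).
   Context: Homotopy type theory with univalent universes $U:\mathsf{Type}$ (with $\mathbb{N}:U$) and function extensionality; $\infty-1=\infty$ and every map is $\infty$-truncated. A map is $j$-truncated if its homotopy fibers $\mathrm{fib}\,g\,y:=\sum_a g\,a=y$ are $j$-types; $A\hookrightarrow_j X$ is the type of $j$-truncated maps; $\mathsf{T}^n_U X:=\sum_{A:U}(A\hookrightarrow_{n-1}X)$. For $x:V$ write $\sup^{ -1}x=(\overline{x},\widetilde{x})$ with $\overline{x}:U$, $\widetilde{x}:\overline{x}\hookrightarrow_{n-1}V$. -}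

module Defs where

open import Level using (Level; _⊔_; 0ℓ) renaming (suc to lsuc)
open import Data.Nat using (ℕ; zero; suc)
open import Data.Product using (Σ; _,_; proj₁; proj₂)
open import Data.Unit.Polymorphic using (⊤)
open import Relation.Binary.PropositionalEquality using (_≡_)
open import Function.Properties.Inverse.HalfAdjointEquivalence public using (_≃_)

private variable ℓ ℓ' : Level

fib : {A : Set ℓ} {B : Set ℓ'} → (A → B) → B → Set (ℓ ⊔ ℓ')
fib {A = A} g y = Σ A λ a → g a ≡ y

data ℕ₋₂ : Set where
  ⟨-2⟩ : ℕ₋₂
  S    : ℕ₋₂ → ℕ₋₂

data ℕ₋₂∞ : Set where
  fin : ℕ₋₂ → ℕ₋₂∞
  ∞   : ℕ₋₂∞

data ℕ∞ : Set where
  fin : ℕ → ℕ∞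
  ∞   : ℕ∞

isContr : Set ℓ → Set ℓ
isContr A = Σ A λ c → (x : A) → c ≡ x

is-_-type : ℕ₋₂ → Set ℓ → Set ℓ
is- ⟨-2⟩ -type A = isContr A
is- S k  -type A = (x y : A) → is- k -type (x ≡ y)

isTruncated : ℕ₋₂∞ → Set ℓ → Set ℓ
isTruncated (fin k) A = is- k -type A
isTruncated ∞       A = ⊤

ℕ→ℕ₋₂ : ℕ → ℕ₋₂
ℕ→ℕ₋₂ zero    = S (S ⟨-2⟩)
ℕ→ℕ₋₂ (suc m) = S (ℕ→ℕ₋₂ m)

-- n - 1 for n ∈ ℕ ∪ {∞}, with ∞ - 1 = ∞ (so 0 - 1 = -1)
_−1 : ℕ∞ → ℕ₋₂∞
fin zero    −1 = fin (S ⟨-2⟩)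
fin (suc m) −1 = fin (ℕ→ℕ₋₂ m)
∞           −1 = ∞

isTruncMap : ℕ₋₂∞ → {A : Set ℓ} {B : Set ℓ'} → (A → B) → Set (ℓ ⊔ ℓ')
isTruncMap j {B = B} g = (y : B) → isTruncated j (fib g y)

_↪[_]_ : Set ℓ → ℕ₋₂∞ → Set ℓ' → Set (ℓ ⊔ ℓ')
A ↪[ j ] X = Σ (A → X) (isTruncMap j)

-- The universe U is Set (= Set₀), which contains ℕ.
U : Set₁
U = Set

T : ℕ∞ → Set ℓ → Set (lsuc 0ℓ ⊔ ℓ)
T n X = Σ U λ A → A ↪[ n −1 ] X

module _ {n : ℕ∞} {V : Set ℓ} (sup : T n V ≃ V) where
  open _≃_ sup renaming (from to sup⁻¹)

  ‾_ : V → U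
  ‾ x = proj₁ (sup⁻¹ x)

  ~_ : (x : V) → ‾ x → V
  ~ x = proj₁ (proj₂ (sup⁻¹ x))

  _∈_ : V → V → Set ℓ
  y ∈ x = fib (~ x) y

-- The map f, being (n-1)-truncated with domain ℕ : U, is itself an element
-- (ℕ , f) of T^n_U V; its image a = sup (ℕ , f) has exactly the elements
-- named by f, because sup⁻¹ a = (ℕ , f) up to a path in T^n_U V.
module Submission where

open import Defs
open import Level using (Level)
open import Data.Nat using (ℕ)
open import Data.Product using (Σ; _,_; proj₁; proj₂)
open import Relation.Binary.PropositionalEquality using (_≡_; refl)
open import Function.Properties.Inverse using (↔-refl)
open import Function.Properties.Inverse.HalfAdjointEquivalence using (↔⇒≃)

≃-refl : ∀ {a} {A : Set a} → A ≃ A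
≃-refl = ↔⇒≃ ↔-refl

fib-≃-cong : ∀ {ℓ} {n : ℕ∞} {V : Set ℓ} {s t : T n V} → s ≡ t → (z : V)
  → fib (proj₁ (proj₂ s)) z ≃ fib (proj₁ (proj₂ t)) z
fib-≃-cong refl z = ≃-refl

-- n must be given explicitly: it is only determined up to n −1, which is not injective.
∈-sup : ∀ {ℓ} {n : ℕ∞} {V : Set ℓ} (sup : T n V ≃ V) (s : T n V) (z : V)
  → _∈_ {n = n} sup z (_≃_.to sup s) ≃ fib (proj₁ (proj₂ s)) z
∈-sup {n = n} sup s = fib-≃-cong {n = n} (_≃_.left-inverse-of sup s)

mainTheorem8 : ∀ {ℓ : Level} (n : ℕ∞) (V : Set ℓ) (sup : T n V ≃ V)
    → (f : ℕ → V) → isTruncMap (n −1) f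
    → Σ V λ a → (z : V) → _∈_ {n = n} sup z a ≃ fib f z
mainTheorem8 n V sup f f-trunc = _≃_.to sup ℕ,f , ∈-sup {n = n} sup ℕ,f
  where
  ℕ,f : T n V
  ℕ,f = ℕ , f , f-trunc
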